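{- For every positive integer $n$, $$\sum_{\pi\in\mathfrak{D}_n}t^{\mathrm{des}_B(\pi)}=\sum_{\pi\in\mathfrak{B}_n^+}t^{\mathrm{des}_B(\pi)}\quad\text{and}\quad\sum_{\pi\in\mathfrak{B}_n\setminus\mathfrak{D}_n}t^{\mathrm{des}_B(\pi)}=\sum_{\pi\in\mathfrak{B}_n^- }t^{\mathrm{des}_B(\pi)}.$$
   Context: $\mathfrak{B}_n$ is the group of signed permutations of $\{\pm1,\dots,\pm n\}$ (bijections with $\pi(-i)=-\pi(i)$), written $\pi=\pi_1\cdots\pi_n$ with $\pi_i=\pi(i)$. $\mathrm{negs}(\pi)=|\{i\in[n]:\pi_i<0\}|$; $\mathfrak{D}_n=\{\pi\in\mathfrak{B}_n:\mathrm{negs}(\pi)\text{ even}\}$. $\mathrm{inv}_B(\pi)=|\{i<j:\pi_i>\pi_j\}|+|\{i<j:-\pi_i>\pi_j\}|+\mathrm{negs}(\pi)$; $\mathfrak{B}_n^{+}$ (resp. $\mathfrak{B}_n^-$) is the set of $\pi$ with $\mathrm{inv}_B(\pi)$ even (resp. odd). With $\pi_0=0$, $\mathrm{des}_B(\pi)=|\{i\in\{0,\dots,n-1\}:\pi_i>\pi_{i+1}\}|$. -}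

module Defs where

open import Data.Nat using (ℕ; zero; suc; _+_)
open import Data.Integer using (ℤ; +_; -_; ∣_∣; _<?_; _≤?_)
open import Data.List using (List; []; _∷_; map; concatMap; length; filter; upTo; applyUpTo; sum)
open import Data.List.Relation.Unary.All using (All; all?)
open import Data.List.Relation.Unary.Any using (Any; any?)
open import Data.Bool using (Bool; true; false; if_then_else_)
open import Relation.Nullary using (Dec; yes; no; ¬?)
open import Relation.Nullary.Decidable using (⌊_⌋)
import Data.Nat as ℕ
open import Relation.Binary.PropositionalEquality using (_≡_)

range : ℕ → List ℤ
range n = map (λ i → - (+ i)) (applyUpTo suc n) Data.List.++ (+ 0 ∷ map +_ (applyUpTo suc n))

words : List ℤ → ℕ → List (List ℤ)
words L zero    = [] ∷ []
words L (suc k) = concatMap (λ x → map (x ∷_) (words L k)) L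

-- A word w of length n with letters in [-n,n] is (the one-line notation of) a signed
-- permutation of {±1,…,±n} iff every j ∈ {1,…,n} occurs as |w_i| for some i.
-- (n positions covering n absolute values forces a bijection and excludes 0.)
IsSignedPerm : ℕ → List ℤ → Set
IsSignedPerm n w = All (λ j → Any (λ x → ∣ x ∣ ≡ j) w) (applyUpTo suc n)

isSignedPerm? : (n : ℕ) → (w : List ℤ) → Dec (IsSignedPerm n w)
isSignedPerm? n w = all? (λ j → any? (λ x → ∣ x ∣ ℕ.≟ j) w) (applyUpTo suc n)

B : ℕ → List (List ℤ)
B n = filter (isSignedPerm? n) (words (range n) n)

negs : List ℤ → ℕ
negs []      = 0
negs (x ∷ w) = (if ⌊ x <? + 0 ⌋ then 1 else 0) + negs w

countLess : ℤ → List ℤ → ℕ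
countLess x []      = 0
countLess x (y ∷ w) = (if ⌊ y <? x ⌋ then 1 else 0) + countLess x w

invPairs : List ℤ → ℕ
invPairs []      = 0
invPairs (x ∷ w) = countLess x w + countLess (- x) w + invPairs w

invB : List ℤ → ℕ
invB w = invPairs w + negs w

des : List ℤ → ℕ
des []          = 0
des (x ∷ [])    = 0
des (x ∷ y ∷ w) = (if ⌊ y <? x ⌋ then 1 else 0) + des (y ∷ w)

desB : List ℤ → ℕ
desB w = des (+ 0 ∷ w)

isEven : ℕ → Bool
isEven zero          = true
isEven (suc zero)    = false
isEven (suc (suc n)) = isEven n

D : ℕ → List (List ℤ)
D n = Data.List.filter (λ w → isEven (negs w) Data.Bool.≟ true) (B n)

BminusD : ℕ → List (List ℤ)
BminusD n = Data.List.filter (λ w → isEven (negs w) Data.Bool.≟ false) (B n)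

Bplus : ℕ → List (List ℤ)
Bplus n = Data.List.filter (λ w → isEven (invB w) Data.Bool.≟ true) (B n)

Bminus : ℕ → List (List ℤ)
Bminus n = Data.List.filter (λ w → isEven (invB w) Data.Bool.≟ false) (B n)

-- Polynomials in t with ℕ coefficients, represented by coefficient functions.
-- desPoly S k = coefficient of t^k in Σ_{π ∈ S} t^{des_B(π)}.
desPoly : List (List ℤ) → ℕ → ℕ
desPoly S k = length (Data.List.filter (λ w → desB w ℕ.≟ k) S)

-- inv_B(π) − negs(π) has the parity of the inversion number of the unsigned permutation |π|:
-- for |π_i| ≠ |π_j| the comparisons of π_j with π_i and with −π_i contribute [|π_j| < |π_i|]
-- modulo 2. So 𝔇_n and 𝔅_n^+ contain the same π with |π| even, and it remains to match the π
-- with |π| odd and negs(π) even against those with negs(π) odd, preserving des_B. Such π have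
-- an absolute descent |π_i| > |π_{i+1}|; negating π_i at the first one changes negs by one and
-- keeps |π|, hence the parity of |π|. It also keeps des_B: as |π_{i-1}| < |π_i| (with π_0 = 0),
-- exactly one of positions i − 1 and i is a descent, whatever the sign of π_i.
module Submission where

open import Defs
open import Data.Nat using (ℕ; zero; suc; _+_; _≤_; _<_; z≤n; s≤s)
import Data.Nat as ℕ
import Data.Nat.Properties as ℕₚ
open import Data.Integer using (ℤ; +_; -[1+_]; -_; ∣_∣; _<?_; +<+; -<+; -<-)
import Data.Integer as ℤ
import Data.Integer.Properties as ℤₚ
open import Data.Bool using (Bool; true; false; if_then_else_; not)
import Data.Bool as Bool
open import Data.List using (List; []; _∷_; map; length; filter; applyUpTo; concatMap; cartesianProductWith; _++_)
import Data.List.Properties as Listₚ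
open import Data.List.Relation.Unary.All as All using (All; []; _∷_)
open import Data.List.Relation.Unary.Any as Any using (Any; here; there)
import Data.List.Relation.Unary.Any.Properties as Anyₚ
open import Data.List.Relation.Unary.AllPairs using ([]; _∷_)
open import Data.List.Relation.Unary.Linked using (Linked; []; [-]; _∷_)
open import Data.List.Relation.Unary.Linked.Properties using (Linked⇒All)
open import Data.List.Relation.Unary.Unique.Propositional using (Unique)
import Data.List.Relation.Unary.Unique.Propositional.Properties as Uniqueₚ
open import Data.List.Membership.Propositional using (_∈_; _∉_)
open import Data.List.Membership.Propositional.Properties
open import Data.List.Relation.Binary.Subset.Propositional using (_⊆_)
open import Data.Product using (_×_; _,_; proj₁; proj₂; ∃)
open import Data.Sum using (_⊎_; inj₁; inj₂)
open import Data.Empty using (⊥-elim)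
open import Function using (_∘_; case_of_)
open import Relation.Nullary using (Dec; yes; no; ¬_; ¬?)
open import Relation.Unary using (Decidable)
open import Relation.Nullary.Decidable using (⌊_⌋)
open import Relation.Binary.PropositionalEquality
open import Relation.Binary.Definitions using (DecidableEquality)
open import Relation.Binary.Bundles using (Setoid)
open import Level using (0ℓ)
import Relation.Binary.Reasoning.Setoid as SetoidReasoning
open import Algebra.Properties.CommutativeSemigroup ℕₚ.+-commutativeSemigroup using (interchange)

isEven-suc : ∀ n → isEven (suc n) ≡ not (isEven n)
isEven-suc zero          = refl
isEven-suc (suc zero)    = refl
isEven-suc (suc (suc n)) = isEven-suc n

infix 4 _≡₂_
record _≡₂_ (m n : ℕ) : Set where
  constructor same-parity
  field isEven-≡ : isEven m ≡ isEven n

open _≡₂_ public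

≡₂-setoid : Setoid 0ℓ 0ℓ
≡₂-setoid = record
  { Carrier       = ℕ
  ; _≈_           = _≡₂_
  ; isEquivalence = record
    { refl  = same-parity refl
    ; sym   = λ m≡₂n → same-parity (sym (isEven-≡ m≡₂n))
    ; trans = λ m≡₂n n≡₂o → same-parity (trans (isEven-≡ m≡₂n) (isEven-≡ n≡₂o))
    }
  }

module ≡₂-Reasoning = SetoidReasoning ≡₂-setoid

+-congˡ-≡₂ : ∀ a {m n} → m ≡₂ n → a + m ≡₂ a + n
+-congˡ-≡₂ zero    m≡₂n = m≡₂n
+-congˡ-≡₂ (suc a) {m} {n} m≡₂n = same-parity (begin
  isEven (suc (a + m)) ≡⟨ isEven-suc (a + m) ⟩
  not (isEven (a + m)) ≡⟨ cong not (isEven-≡ (+-congˡ-≡₂ a m≡₂n)) ⟩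
  not (isEven (a + n)) ≡⟨ isEven-suc (a + n) ⟨
  isEven (suc (a + n)) ∎)
  where open ≡-Reasoning

+-cong-≡₂ : ∀ {a b m n} → a ≡₂ b → m ≡₂ n → a + m ≡₂ b + n
+-cong-≡₂ {a} {b} {m} {n} a≡₂b m≡₂n = begin
  a + m ≈⟨ +-congˡ-≡₂ a m≡₂n ⟩
  a + n ≡⟨ ℕₚ.+-comm a n ⟩
  n + a ≈⟨ +-congˡ-≡₂ n a≡₂b ⟩
  n + b ≡⟨ ℕₚ.+-comm n b ⟩
  b + n ∎
  where open ≡₂-Reasoning

+-congʳ-≡₂ : ∀ a {m n} → m ≡₂ n → m + a ≡₂ n + a
+-congʳ-≡₂ a m≡₂n = +-cong-≡₂ m≡₂n (same-parity refl)

iverson : {P : Set} → Dec P → ℕ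
iverson d = if ⌊ d ⌋ then 1 else 0

iverson-yes : ∀ {P : Set} (d : Dec P) → P → iverson d ≡ 1
iverson-yes (yes _) _ = refl
iverson-yes (no ¬p) p = ⊥-elim (¬p p)

iverson-no : ∀ {P : Set} (d : Dec P) → ¬ P → iverson d ≡ 0
iverson-no (yes p) ¬p = ⊥-elim (¬p p)
iverson-no (no _)  _  = refl

∣i∣<n⇒i<n : ∀ {n} i → ∣ i ∣ < n → i ℤ.< + n
∣i∣<n⇒i<n (+ k)    k<n = +<+ k<n
∣i∣<n⇒i<n -[1+ k ] _   = -<+

∣i∣<n⇒-n<i : ∀ {n} i → ∣ i ∣ < n → - (+ n) ℤ.< i
∣i∣<n⇒-n<i {suc n} (+ k)    _           = -<+
∣i∣<n⇒-n<i {suc n} -[1+ k ] (s≤s k<n) = -<- k<n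

descents-neg-peak : ∀ p x y → ∣ p ∣ < ∣ x ∣ → ∣ y ∣ < ∣ x ∣ →
  iverson (- x <? p) + iverson (y <? - x) ≡ iverson (x <? p) + iverson (y <? x)
descents-neg-peak p (+ zero)  y () _
descents-neg-peak p (+ suc a) y p<x y<x
  rewrite iverson-yes (-[1+ a ] <? p) (∣i∣<n⇒-n<i p p<x)
        | iverson-no (y <? -[1+ a ]) (ℤₚ.<-asym (∣i∣<n⇒-n<i y y<x))
        | iverson-no (+ suc a <? p) (ℤₚ.<-asym (∣i∣<n⇒i<n p p<x))
        | iverson-yes (y <? + suc a) (∣i∣<n⇒i<n y y<x) = refl
descents-neg-peak p -[1+ a ] y p<x y<x = sym (descents-neg-peak p (+ suc a) y p<x y<x)

signed-inversions-parity : ∀ x y → ∣ y ∣ ≢ ∣ x ∣ →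
  iverson (y <? x) + iverson (y <? - x) ≡₂ iverson (∣ y ∣ ℕ.<? ∣ x ∣)
signed-inversions-parity x y y≢x with ∣ y ∣ ℕ.<? ∣ x ∣
... | yes y<x = same-parity (cong isEven (exactly-one x y y<x))
  where
  exactly-one : ∀ x y → ∣ y ∣ < ∣ x ∣ → iverson (y <? x) + iverson (y <? - x) ≡ 1
  exactly-one (+ zero)  y ()
  exactly-one (+ suc a) y y<x
    rewrite iverson-yes (y <? + suc a) (∣i∣<n⇒i<n y y<x)
          | iverson-no (y <? -[1+ a ]) (ℤₚ.<-asym (∣i∣<n⇒-n<i y y<x)) = refl
  exactly-one -[1+ a ] y y<x =
    trans (ℕₚ.+-comm (iverson (y <? -[1+ a ])) _) (exactly-one (+ suc a) y y<x)
... | no y≮x = both-or-neither y x (ℕₚ.≤∧≢⇒< (ℕₚ.≮⇒≥ y≮x) (λ x≡y → y≢x (sym x≡y)))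
  where
  both-or-neither : ∀ y x → ∣ x ∣ < ∣ y ∣ → iverson (y <? x) + iverson (y <? - x) ≡₂ 0
  both-or-neither (+ zero)  x ()
  both-or-neither (+ suc c) x x<y
    rewrite iverson-no (+ suc c <? x) (ℤₚ.<-asym (∣i∣<n⇒i<n x x<y))
          | iverson-no (+ suc c <? - x)
              (ℤₚ.<-asym (∣i∣<n⇒i<n (- x) (subst (_< suc c) (sym (ℤₚ.∣-i∣≡∣i∣ x)) x<y))) = same-parity refl
  both-or-neither -[1+ c ] x x<y
    rewrite iverson-yes (-[1+ c ] <? x) (∣i∣<n⇒-n<i x x<y)
          | iverson-yes (-[1+ c ] <? - x)
              (∣i∣<n⇒-n<i (- x) (subst (_< suc c) (sym (ℤₚ.∣-i∣≡∣i∣ x)) x<y)) = same-parity refl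

negs-neg : ∀ x n → 0 < ∣ x ∣ → suc (iverson (- x <? + 0) + n) ≡₂ iverson (x <? + 0) + n
negs-neg (+ zero)  n ()
negs-neg (+ suc a) n _
  rewrite iverson-yes (-[1+ a ] <? + 0) -<+ | iverson-no (+ suc a <? + 0) (λ { (+<+ ()) }) = same-parity refl
negs-neg -[1+ a ]  n _
  rewrite iverson-no (+ suc a <? + 0) (λ { (+<+ ()) }) | iverson-yes (-[1+ a ] <? + 0) -<+ = same-parity refl

negFirstAbsDescent : List ℤ → List ℤ
negFirstAbsDescent (x ∷ y ∷ w) =
  if ⌊ ∣ y ∣ ℕ.<? ∣ x ∣ ⌋ then - x ∷ y ∷ w else x ∷ negFirstAbsDescent (y ∷ w)
negFirstAbsDescent w = w

private
  ν = negFirstAbsDescent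

ν-here : ∀ x y w → ∣ y ∣ < ∣ x ∣ → ν (x ∷ y ∷ w) ≡ - x ∷ y ∷ w
ν-here x y w y<x with ∣ y ∣ ℕ.<? ∣ x ∣
... | yes _   = refl
... | no  y≮x = ⊥-elim (y≮x y<x)

ν-later : ∀ x y w → ∣ x ∣ ≤ ∣ y ∣ → ν (x ∷ y ∷ w) ≡ x ∷ ν (y ∷ w)
ν-later x y w x≤y with ∣ y ∣ ℕ.<? ∣ x ∣
... | yes y<x = ⊥-elim (ℕₚ.<-irrefl refl (ℕₚ.<-≤-trans y<x x≤y))
... | no  _   = refl

ν-abs : ∀ w → map ∣_∣ (ν w) ≡ map ∣_∣ w
ν-abs []          = refl
ν-abs (x ∷ [])    = refl
ν-abs (x ∷ y ∷ w) with ∣ y ∣ ℕ.<? ∣ x ∣ | ν-abs (y ∷ w)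
... | yes _ | _  = cong (_∷ map ∣_∣ (y ∷ w)) (ℤₚ.∣-i∣≡∣i∣ x)
... | no  _ | ih = cong (∣ x ∣ ∷_) ih

ν-involutive : ∀ w → ν (ν w) ≡ w
ν-involutive []          = refl
ν-involutive (x ∷ [])    = refl
ν-involutive (x ∷ y ∷ w) with ∣ y ∣ ℕ.<? ∣ x ∣ | ν-involutive (y ∷ w)
... | yes y<x | _ = begin
  ν (- x ∷ y ∷ w) ≡⟨ ν-here (- x) y w (subst (∣ y ∣ <_) (sym (ℤₚ.∣-i∣≡∣i∣ x)) y<x) ⟩
  - - x ∷ y ∷ w   ≡⟨ cong (_∷ y ∷ w) (ℤₚ.neg-involutive x) ⟩
  x ∷ y ∷ w       ∎
  where open ≡-Reasoning
... | no y≮x | ih with ν (y ∷ w) | ν-abs (y ∷ w)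
...   | y′ ∷ w′ | abs-eq = begin
  ν (x ∷ y′ ∷ w′)  ≡⟨ ν-later x y′ w′ x≤y′ ⟩
  x ∷ ν (y′ ∷ w′)  ≡⟨ cong (x ∷_) ih ⟩
  x ∷ y ∷ w        ∎
  where
  open ≡-Reasoning
  x≤y′ : ∣ x ∣ ≤ ∣ y′ ∣
  x≤y′ = subst (∣ x ∣ ≤_) (sym (Listₚ.∷-injectiveˡ abs-eq)) (ℕₚ.≮⇒≥ y≮x)

ν-All : ∀ {P : ℤ → Set} → (∀ {x} → P x → P (- x)) → ∀ {w} → All P w → All P (ν w)
ν-All neg {[]}        ps = ps
ν-All neg {x ∷ []}    ps = ps
ν-All neg {x ∷ y ∷ w} (px ∷ ps) with ∣ y ∣ ℕ.<? ∣ x ∣ | ν-All neg ps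
... | yes _ | _  = neg px ∷ ps
... | no  _ | ih = px ∷ ih

ν-fixed⇒ascending : ∀ w → ν w ≡ w → Linked _≤_ (map ∣_∣ w)
ν-fixed⇒ascending []          _ = []
ν-fixed⇒ascending (x ∷ [])    _ = [-]
ν-fixed⇒ascending (x ∷ y ∷ w) fixed with ∣ y ∣ ℕ.<? ∣ x ∣ | ν-fixed⇒ascending (y ∷ w)
... | yes y<x | _ = ⊥-elim (neg-fixed⇒zero x y<x (Listₚ.∷-injectiveˡ fixed))
  where
  neg-fixed⇒zero : ∀ x → ∣ y ∣ < ∣ x ∣ → - x ≢ x
  neg-fixed⇒zero (+ zero)  ()
  neg-fixed⇒zero (+ suc _) _ ()
  neg-fixed⇒zero -[1+ _ ]  _ ()
... | no y≮x | ih = ℕₚ.≮⇒≥ y≮x ∷ ih (Listₚ.∷-injectiveʳ fixed)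

des-ν : ∀ p x w → ∣ p ∣ < ∣ x ∣ → Unique (map ∣_∣ (x ∷ w)) →
        des (p ∷ ν (x ∷ w)) ≡ des (p ∷ x ∷ w)
des-ν p x []      _   _ = refl
des-ν p x (y ∷ w) p<x (x∉ ∷ unique) with ∣ y ∣ ℕ.<? ∣ x ∣
... | yes y<x = begin
  iverson (- x <? p) + (iverson (y <? - x) + des (y ∷ w))
    ≡⟨ ℕₚ.+-assoc (iverson (- x <? p)) _ _ ⟨
  (iverson (- x <? p) + iverson (y <? - x)) + des (y ∷ w)
    ≡⟨ cong (_+ des (y ∷ w)) (descents-neg-peak p x y p<x y<x) ⟩
  (iverson (x <? p) + iverson (y <? x)) + des (y ∷ w)
    ≡⟨ ℕₚ.+-assoc (iverson (x <? p)) _ _ ⟩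
  iverson (x <? p) + (iverson (y <? x) + des (y ∷ w)) ∎
  where open ≡-Reasoning
... | no y≮x = cong (iverson (x <? p) ℕ.+_) (des-ν x y w x<y unique)
  where x<y = ℕₚ.≤∧≢⇒< (ℕₚ.≮⇒≥ y≮x) (All.head x∉)

negs-ν : ∀ w → ν w ≢ w → suc (negs (ν w)) ≡₂ negs w
negs-ν []          moved = ⊥-elim (moved refl)
negs-ν (x ∷ [])    moved = ⊥-elim (moved refl)
negs-ν (x ∷ y ∷ w) moved with ∣ y ∣ ℕ.<? ∣ x ∣ | negs-ν (y ∷ w)
... | yes y<x | _  = negs-neg x (negs (y ∷ w)) (ℕₚ.<-≤-trans (s≤s z≤n) y<x)
... | no  _   | ih = begin
  suc (iverson (x <? + 0) + negs (ν (y ∷ w)))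
    ≡⟨ ℕₚ.+-suc (iverson (x <? + 0)) _ ⟨
  iverson (x <? + 0) + suc (negs (ν (y ∷ w)))
    ≈⟨ +-congˡ-≡₂ (iverson (x <? + 0)) (ih (λ fixed → moved (cong (x ∷_) fixed))) ⟩
  iverson (x <? + 0) + negs (y ∷ w) ∎
  where open ≡₂-Reasoning

countBelow : ℕ → List ℕ → ℕ
countBelow a []      = 0
countBelow a (b ∷ r) = iverson (b ℕ.<? a) + countBelow a r

inversions : List ℕ → ℕ
inversions []      = 0
inversions (a ∷ r) = countBelow a r + inversions r

countBelow-≤ : ∀ {a r} → All (a ≤_) r → countBelow a r ≡ 0
countBelow-≤ []                    = refl
countBelow-≤ {a} {b ∷ r} (a≤b ∷ a≤r)
  rewrite iverson-no (b ℕ.<? a) (ℕₚ.≤⇒≯ a≤b) = countBelow-≤ a≤r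

inversions-ascending : ∀ {r} → Linked _≤_ r → inversions r ≡ 0
inversions-ascending []                = refl
inversions-ascending [-]               = refl
inversions-ascending (a≤b ∷ ascending) rewrite countBelow-≤ (Linked⇒All ℕₚ.≤-trans a≤b ascending) =
  inversions-ascending ascending

countLess-parity : ∀ x r → All (∣ x ∣ ≢_) (map ∣_∣ r) →
  countLess x r + countLess (- x) r ≡₂ countBelow ∣ x ∣ (map ∣_∣ r)
countLess-parity x []      _ = same-parity refl
countLess-parity x (y ∷ r) (x≢y ∷ x∉r) = begin
  (iverson (y <? x) + countLess x r) + (iverson (y <? - x) + countLess (- x) r)
    ≡⟨ interchange (iverson (y <? x)) _ _ _ ⟩
  (iverson (y <? x) + iverson (y <? - x)) + (countLess x r + countLess (- x) r)
    ≈⟨ +-cong-≡₂ (signed-inversions-parity x y (λ y≡x → x≢y (sym y≡x))) (countLess-parity x r x∉r) ⟩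
  iverson (∣ y ∣ ℕ.<? ∣ x ∣) + countBelow ∣ x ∣ (map ∣_∣ r) ∎
  where open ≡₂-Reasoning

invPairs-parity : ∀ w → Unique (map ∣_∣ w) → invPairs w ≡₂ inversions (map ∣_∣ w)
invPairs-parity []      _              = same-parity refl
invPairs-parity (x ∷ r) (x∉r ∷ unique) =
  +-cong-≡₂ (countLess-parity x r x∉r) (invPairs-parity r unique)

module _ {A : Set} (_≟_ : DecidableEquality A) where

  private
    remove : A → List A → List A
    remove y = filter (λ z → ¬? (z ≟ y))

    length-remove : ∀ {y xs} → Unique xs → length xs ≤ suc (length (remove y xs))
    length-remove {y} {[]}     _ = z≤n
    length-remove {y} {x ∷ xs} (x∉ ∷ unique) with x ≟ y
    ... | yes refl = s≤s (ℕₚ.≤-reflexive (sym (cong length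
                       (Listₚ.filter-all (λ z → ¬? (z ≟ x)) (All.map (λ x≢z z≡x → x≢z (sym z≡x)) x∉)))))
    ... | no  _    = s≤s (length-remove unique)

  Unique-⊆⇒length-≤ : ∀ {xs ys} → Unique xs → xs ⊆ ys → length xs ≤ length ys
  Unique-⊆⇒length-≤ {[]}     _             _   = z≤n
  Unique-⊆⇒length-≤ {x ∷ xs} {ys} (x∉ ∷ unique) sub = ℕₚ.≤-trans
    (s≤s (Unique-⊆⇒length-≤ unique sub′))
    (Listₚ.filter-notAll (λ z → ¬? (z ≟ x)) ys (Any.map (λ z≡x z≢x → z≢x (sym z≡x)) (sub (here refl))))
    where
    sub′ : xs ⊆ remove x ys
    sub′ z∈xs = ∈-filter⁺ (λ z → ¬? (z ≟ x)) (sub (there z∈xs)) (λ z≡x → All.lookup x∉ z∈xs (sym z≡x))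

  pigeonhole : ∀ {xs ys} → Unique xs → xs ⊆ ys → length ys ≤ length xs → Unique ys
  pigeonhole {xs} {[]}     _      _   _   = []
  pigeonhole {xs} {y ∷ ys} unique sub len = All.tabulate y∉ys ∷ pigeonhole unique′ sub′ len′
    where
    y∉ys : ∀ {z} → z ∈ ys → y ≢ z
    y∉ys z∈ys refl = ℕₚ.<-irrefl refl (ℕₚ.≤-trans len (Unique-⊆⇒length-≤ unique sub″))
      where
      sub″ : xs ⊆ ys
      sub″ v∈xs with sub v∈xs
      ... | here refl = z∈ys
      ... | there v∈ys = v∈ys
    unique′ : Unique (remove y xs)
    unique′ = Uniqueₚ.filter⁺ (λ z → ¬? (z ≟ y)) unique
    sub′ : remove y xs ⊆ ys
    sub′ z∈xs′ with ∈-filter⁻ (λ z → ¬? (z ≟ y)) z∈xs′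
    ... | z∈xs , z≢y with sub z∈xs
    ...   | here z≡y   = ⊥-elim (z≢y z≡y)
    ...   | there z∈ys = z∈ys
    len′ : length ys ≤ length (remove y xs)
    len′ = ℕₚ.≤-pred (ℕₚ.≤-trans len (length-remove unique))

  involution⇒length-≡ : (f : A → A) → (∀ x → f (f x) ≡ x) → ∀ {xs ys} → Unique xs → Unique ys →
    (∀ {x} → x ∈ xs → f x ∈ ys) → (∀ {y} → y ∈ ys → f y ∈ xs) → length xs ≡ length ys
  involution⇒length-≡ f f-involutive unique-xs unique-ys xs→ys ys→xs =
    ℕₚ.≤-antisym (image-≤ unique-xs xs→ys) (image-≤ unique-ys ys→xs)
    where
    f-injective : ∀ {x y} → f x ≡ f y → x ≡ y
    f-injective {x} {y} fx≡fy = trans (sym (f-involutive x)) (trans (cong f fx≡fy) (f-involutive y))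
    image-≤ : ∀ {us vs} → Unique us → (∀ {u} → u ∈ us → f u ∈ vs) → length us ≤ length vs
    image-≤ {us} unique into = subst (_≤ _) (Listₚ.length-map f us)
      (Unique-⊆⇒length-≤ (Uniqueₚ.map⁺ f-injective unique)
        λ v∈fus → case ∈-map⁻ f v∈fus of λ { (u , u∈us , refl) → into u∈us })

words-suc : ∀ L k → words L (suc k) ≡ cartesianProductWith _∷_ L (words L k)
words-suc L k = go L
  where
  go : ∀ xs → concatMap (λ x → map (x ∷_) (words L k)) xs ≡ cartesianProductWith _∷_ xs (words L k)
  go []       = refl
  go (x ∷ xs) = cong (map (x ∷_) (words L k) ++_) (go xs)

∈-words⁻ : ∀ L k {w} → w ∈ words L k → length w ≡ k × All (_∈ L) w
∈-words⁻ L zero    (here refl) = refl , []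
∈-words⁻ L (suc k) w∈ with ∈-cartesianProductWith⁻ _∷_ L (words L k) (subst (_ ∈_) (words-suc L k) w∈)
... | x , v , x∈L , v∈ , refl with ∈-words⁻ L k v∈
...   | len , all = cong suc len , x∈L ∷ all

∈-words⁺ : ∀ L k {w} → length w ≡ k → All (_∈ L) w → w ∈ words L k
∈-words⁺ L zero    {[]}    _   _            = here refl
∈-words⁺ L (suc k) {x ∷ v} len (x∈L ∷ all) = subst (_ ∈_) (sym (words-suc L k))
  (∈-cartesianProductWith⁺ _∷_ x∈L (∈-words⁺ L k (ℕₚ.suc-injective len) all))

words-unique : ∀ {L} k → Unique L → Unique (words L k)
words-unique zero    _        = [] ∷ []
words-unique {L} (suc k) unique = subst Unique (sym (words-suc L k))
  (Uniqueₚ.cartesianProductWith⁺ _∷_ Listₚ.∷-injective unique (words-unique k unique))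

oneTo : ℕ → List ℕ
oneTo n = applyUpTo suc n

oneTo-unique : ∀ n → Unique (oneTo n)
oneTo-unique n = Uniqueₚ.applyUpTo⁺₁ suc n (λ i<j _ → ℕₚ.<⇒≢ i<j ∘ ℕₚ.suc-injective)

∈-oneTo⇒suc : ∀ {n v} → v ∈ oneTo n → ∃ λ i → v ≡ suc i
∈-oneTo⇒suc v∈ with ∈-applyUpTo⁻ suc v∈
... | i , _ , v≡1+i = i , v≡1+i

range-neg : ∀ n {x} → x ∈ range n → - x ∈ range n
range-neg n x∈ with ∈-++⁻ (map (λ i → - (+ i)) (oneTo n)) x∈
... | inj₁ x∈neg with ∈-map⁻ (λ i → - (+ i)) x∈neg
...   | i , i∈ , refl = ∈-++⁺ʳ (map (λ i → - (+ i)) (oneTo n))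
                          (there (subst (_∈ map +_ (oneTo n)) (sym (ℤₚ.neg-involutive (+ i))) (∈-map⁺ +_ i∈)))
range-neg n x∈ | inj₂ (here refl) = x∈
range-neg n x∈ | inj₂ (there x∈pos) with ∈-map⁻ +_ x∈pos
...   | i , i∈ , refl = ∈-++⁺ˡ (∈-map⁺ (λ i → - (+ i)) i∈)

range-unique : ∀ n → Unique (range n)
range-unique n = Uniqueₚ.++⁺
  (Uniqueₚ.map⁺ (ℤₚ.+-injective ∘ ℤₚ.neg-injective) (oneTo-unique n))
  (All.tabulate 0∉pos ∷ Uniqueₚ.map⁺ ℤₚ.+-injective (oneTo-unique n))
  disjoint
  where
  0∉pos : ∀ {v} → v ∈ map +_ (oneTo n) → + 0 ≢ v
  0∉pos v∈ with ∈-map⁻ +_ v∈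
  ... | i , i∈ , refl with ∈-oneTo⇒suc i∈
  ...   | _ , refl = λ ()
  disjoint : ∀ {v} → ¬ (v ∈ map (λ i → - (+ i)) (oneTo n) × v ∈ + 0 ∷ map +_ (oneTo n))
  disjoint (v∈neg , v∈nonneg) with ∈-map⁻ (λ i → - (+ i)) v∈neg
  ... | i , i∈ , refl with ∈-oneTo⇒suc i∈ | v∈nonneg
  ...   | _ , refl | here ()
  ...   | _ , refl | there v∈pos with ∈-map⁻ +_ v∈pos
  ...     | _ , _ , ()

abs-covers : ∀ {n w} → IsSignedPerm n w → oneTo n ⊆ map ∣_∣ w
abs-covers perm j∈ = Any.map sym (Anyₚ.map⁺ (All.lookup perm j∈))

IsSignedPerm-abs : ∀ {n v w} → map ∣_∣ v ≡ map ∣_∣ w → IsSignedPerm n w → IsSignedPerm n v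
IsSignedPerm-abs v≈w = All.map λ occurs → Anyₚ.map⁻ (subst (Any (_≡ _)) (sym v≈w) (Anyₚ.map⁺ occurs))

∈B⁻ : ∀ n {w} → w ∈ B n → w ∈ words (range n) n × IsSignedPerm n w
∈B⁻ n = ∈-filter⁻ (isSignedPerm? n) {xs = words (range n) n}

module _ (n : ℕ) {w} (w∈B : w ∈ B n) where

  private
    w∈words = proj₁ (∈B⁻ n w∈B)
    perm    = proj₂ (∈B⁻ n w∈B)

    length-abs : length (map ∣_∣ w) ≡ length (oneTo n)
    length-abs = begin
      length (map ∣_∣ w) ≡⟨ Listₚ.length-map ∣_∣ w ⟩
      length w           ≡⟨ proj₁ (∈-words⁻ (range n) n w∈words) ⟩
      n                  ≡⟨ Listₚ.length-applyUpTo suc n ⟨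
      length (oneTo n)   ∎
      where open ≡-Reasoning

  ∈B⇒abs-unique : Unique (map ∣_∣ w)
  ∈B⇒abs-unique = pigeonhole ℕₚ._≟_ (oneTo-unique n) (abs-covers perm) (ℕₚ.≤-reflexive length-abs)

  ∈B⇒0∉abs : 0 ∉ map ∣_∣ w
  ∈B⇒0∉abs 0∈ = ℕₚ.<⇒≱ ℕₚ.≤-refl (subst (_ ≤_) length-abs (Unique-⊆⇒length-≤ ℕₚ._≟_ unique sub))
    where
    unique : Unique (0 ∷ oneTo n)
    unique = All.tabulate (λ j∈ 0≡j → case ∈-oneTo⇒suc j∈ of λ { (_ , refl) → ℕₚ.0≢1+n 0≡j }) ∷ oneTo-unique n
    sub : 0 ∷ oneTo n ⊆ map ∣_∣ w
    sub (here refl) = 0∈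
    sub (there j∈)  = abs-covers perm j∈

  ν-∈B : ν w ∈ B n
  ν-∈B = ∈-filter⁺ (isSignedPerm? n) (∈-words⁺ (range n) n length-ν (ν-All (range-neg n) letters))
    (IsSignedPerm-abs (ν-abs w) perm)
    where
    letters = proj₂ (∈-words⁻ (range n) n w∈words)
    length-ν : length (ν w) ≡ n
    length-ν = begin
      length (ν w)           ≡⟨ Listₚ.length-map ∣_∣ (ν w) ⟨
      length (map ∣_∣ (ν w)) ≡⟨ cong length (ν-abs w) ⟩
      length (map ∣_∣ w)     ≡⟨ length-abs ⟩
      length (oneTo n)       ≡⟨ Listₚ.length-applyUpTo suc n ⟩
      n                      ∎
      where open ≡-Reasoning

B-unique : ∀ n → Unique (B n)
B-unique n = Uniqueₚ.filter⁺ (isSignedPerm? n) (words-unique n (range-unique n))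

desB-ν : ∀ w → 0 ∉ map ∣_∣ w → Unique (map ∣_∣ w) → desB (ν w) ≡ desB w
desB-ν []      _  _      = refl
desB-ν (x ∷ r) 0∉ unique = des-ν (+ 0) x r (ℕₚ.n≢0⇒n>0 (λ ∣x∣≡0 → 0∉ (here (sym ∣x∣≡0)))) unique

true≢false : true ≢ false
true≢false ()

-- ν where |π| is an odd permutation, the identity elsewhere; an involution because ν preserves |π|.
ι : List ℤ → List ℤ
ι w = if isEven (inversions (map ∣_∣ w)) then w else ν w

ι-cases : ∀ w → (inversions (map ∣_∣ w) ≡₂ 0 × ι w ≡ w) ⊎ (inversions (map ∣_∣ w) ≡₂ 1 × ι w ≡ ν w)
ι-cases w with isEven (inversions (map ∣_∣ w)) in even?
... | true  = inj₁ (same-parity even? , refl)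
... | false = inj₂ (same-parity even? , refl)

ι-involutive : ∀ w → ι (ι w) ≡ w
ι-involutive w with ι-cases w
... | inj₁ (_ , ιw≡w) = trans (cong ι ιw≡w) ιw≡w
... | inj₂ (odd , ιw≡νw) with ι-cases (ν w)
...   | inj₁ (even , _) = ⊥-elim (true≢false (trans (sym (isEven-≡ even′)) (isEven-≡ odd)))
  where even′ = subst (_≡₂ 0) (cong inversions (ν-abs w)) even
...   | inj₂ (_ , ινw≡ννw) = trans (cong ι ιw≡νw) (trans ινw≡ννw (ν-involutive w))

module _ (n : ℕ) {w} (w∈B : w ∈ B n) where

  ι-∈B : ι w ∈ B n
  ι-∈B with ι-cases w
  ... | inj₁ (_ , ιw≡w)  = subst (_∈ B n) (sym ιw≡w) w∈B
  ... | inj₂ (_ , ιw≡νw) = subst (_∈ B n) (sym ιw≡νw) (ν-∈B n w∈B)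

  ι-desB : desB (ι w) ≡ desB w
  ι-desB with ι-cases w
  ... | inj₁ (_ , ιw≡w)  = cong desB ιw≡w
  ... | inj₂ (_ , ιw≡νw) = trans (cong desB ιw≡νw) (desB-ν w (∈B⇒0∉abs n w∈B) (∈B⇒abs-unique n w∈B))

  ι-invB : invB (ι w) ≡₂ negs w
  ι-invB with ι-cases w
  ... | inj₁ (even , ιw≡w) = begin
    invPairs (ι w) + negs (ι w)             ≡⟨ cong invB ιw≡w ⟩
    invPairs w + negs w                     ≈⟨ +-congʳ-≡₂ (negs w) (invPairs-parity w unique) ⟩
    inversions (map ∣_∣ w) + negs w         ≈⟨ +-congʳ-≡₂ (negs w) even ⟩
    negs w                                  ∎
    where
    open ≡₂-Reasoning
    unique = ∈B⇒abs-unique n w∈B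
  ... | inj₂ (odd , ιw≡νw) = begin
    invPairs (ι w) + negs (ι w)             ≡⟨ cong invB ιw≡νw ⟩
    invPairs (ν w) + negs (ν w)             ≈⟨ +-congʳ-≡₂ (negs (ν w)) (invPairs-parity (ν w) unique-ν) ⟩
    inversions (map ∣_∣ (ν w)) + negs (ν w) ≡⟨ cong (λ v → inversions v + negs (ν w)) (ν-abs w) ⟩
    inversions (map ∣_∣ w) + negs (ν w)     ≈⟨ +-congʳ-≡₂ (negs (ν w)) odd ⟩
    suc (negs (ν w))                        ≈⟨ negs-ν w moved ⟩
    negs w                                  ∎
    where
    open ≡₂-Reasoning
    unique-ν : Unique (map ∣_∣ (ν w))
    unique-ν = subst Unique (sym (ν-abs w)) (∈B⇒abs-unique n w∈B)
    moved : ν w ≢ w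
    moved fixed = true≢false (trans
      (cong isEven (sym (inversions-ascending (ν-fixed⇒ascending w fixed)))) (isEven-≡ odd))

ι-negs : ∀ n {w} → w ∈ B n → negs (ι w) ≡₂ invB w
ι-negs n {w} w∈B = same-parity (sym (isEven-≡ invB-ιιw))
  where
  invB-ιιw : invB w ≡₂ negs (ι w)
  invB-ιιw = subst (λ v → invB v ≡₂ negs (ι w)) (ι-involutive w) (ι-invB n (ι-∈B n w∈B))

module _ (n k : ℕ) (s : Bool) where

  private
    has-des : (w : List ℤ) → Dec (desB w ≡ k)
    has-des w = desB w ℕ.≟ k

    ∈-filter²⁻ : ∀ {E : List ℤ → Set} (E? : Decidable E) {w} →
      w ∈ filter has-des (filter E? (B n)) → w ∈ B n × E w × desB w ≡ k
    ∈-filter²⁻ E? w∈ with ∈-filter⁻ has-des {xs = filter E? (B n)} w∈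
    ... | w∈′ , des≡k with ∈-filter⁻ E? {xs = B n} w∈′
    ...   | w∈B , Ew = w∈B , Ew , des≡k

    filter²-unique : ∀ {E : List ℤ → Set} (E? : Decidable E) → Unique (filter has-des (filter E? (B n)))
    filter²-unique E? = Uniqueₚ.filter⁺ has-des (Uniqueₚ.filter⁺ E? (B-unique n))

  desPoly-negs≡desPoly-invB :
    desPoly (filter (λ w → isEven (negs w) Bool.≟ s) (B n)) k ≡
    desPoly (filter (λ w → isEven (invB w) Bool.≟ s) (B n)) k
  desPoly-negs≡desPoly-invB = involution⇒length-≡ (Listₚ.≡-dec ℤₚ._≟_) ι ι-involutive
    (filter²-unique negs?) (filter²-unique invB?) negs→invB invB→negs
    where
    negs? : (w : List ℤ) → Dec (isEven (negs w) ≡ s)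
    negs? w = isEven (negs w) Bool.≟ s
    invB? : (w : List ℤ) → Dec (isEven (invB w) ≡ s)
    invB? w = isEven (invB w) Bool.≟ s
    negs→invB : ∀ {w} → w ∈ filter has-des (filter negs? (B n)) → ι w ∈ filter has-des (filter invB? (B n))
    negs→invB w∈ with ∈-filter²⁻ negs? w∈
    ... | w∈B , negs≡s , des≡k = ∈-filter⁺ has-des
      (∈-filter⁺ invB? (ι-∈B n w∈B) (trans (isEven-≡ (ι-invB n w∈B)) negs≡s)) (trans (ι-desB n w∈B) des≡k)
    invB→negs : ∀ {w} → w ∈ filter has-des (filter invB? (B n)) → ι w ∈ filter has-des (filter negs? (B n))
    invB→negs w∈ with ∈-filter²⁻ invB? w∈
    ... | w∈B , invB≡s , des≡k = ∈-filter⁺ has-des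
      (∈-filter⁺ negs? (ι-∈B n w∈B) (trans (isEven-≡ (ι-negs n w∈B)) invB≡s)) (trans (ι-desB n w∈B) des≡k)

corollary5p2 : (n : ℕ) → 1 Data.Nat.≤ n →
    ((k : ℕ) → desPoly (D n) k ≡ desPoly (Bplus n) k) ×
    ((k : ℕ) → desPoly (BminusD n) k ≡ desPoly (Bminus n) k)
corollary5p2 n _ = (λ k → desPoly-negs≡desPoly-invB n k true) , (λ k → desPoly-negs≡desPoly-invB n k false)
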